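{- Let $x$ be a variable. For all finitely supported sequences $v=(v_j)_{j\ge1}$ and $u=(u_j)_{j\ge1}$ of nonnegative integers, the partition function of the following two-row lattice equals $\delta_{u,v}$ (i.e. $\mathfrak t(-x)\tilde t(x)=1$): the bottom row has horizontal labels in $\{0,1\}$, bottom labels $v$, right boundary value $0$, free left boundary, and weights (with $y=-x$, $m\ge0$ unless stated) $w(0,m;0,m)=1$, $w(0,m;1,m-1)=1$ ($m\ge1$), $w(1,m;0,m+1)=y$, $w(1,m;1,m)=y$ ($m\ge1$), $w(1,0;1,0)=y+1$, all others $0$; the top row has nonnegative integer horizontal labels, top labels $u$, right boundary value $0$, free left boundary, and weights $\tilde w(a,b;c,d)=\delta_{a+b,c+d}\,x^{\min(a,d)}$.
   Context: A vertex has left label $a$, bottom label $b$, right label $c$, top label $d$. A row is a sequence of vertices at sites $j=1,2,\dots$, the right label at site $j$ being the left label at site $j+1$; vertical labels are nonnegative integers; the left label at site $1$ is free (summed over) and the right labels must be eventually equal to the prescribed value. In the two-row lattice, the top labels of the bottom row are the bottom labels of the top row and are summed over; the partition function is the sum over all labelings of non-prescribed edges of the product of vertex weights. The bottom row is the row transfer matrix for the weak dual Grothendieck polynomials $g^{(1,0)}_{\lambda'}$ at parameter $-x$; the top row is the column transfer matrix for $g^{(0,1)}_\lambda$ at parameter $x$. -}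

module Defs where

open import Level using (Level)
open import Algebra.Bundles using (CommutativeRing)
open import Data.Nat using (ℕ; zero; suc; _+_; _⊓_; _≡ᵇ_)
import Data.Nat.Properties as ℕP
open import Data.Bool using (Bool; true; false; if_then_else_; _∧_)
open import Data.Vec using (Vec; []; _∷_)
import Data.Vec as Vec
open import Data.Vec.Properties using (≡-dec)
open import Relation.Nullary.Decidable using (does)

-- An identity holding for every commutative ring R and every x ∈ R is exactly
-- an identity in the polynomial ring ℤ[x] (x a variable).
module Lattice {c ℓ : Level} (R : CommutativeRing c ℓ) where
  open CommutativeRing R renaming (_+_ to _+R_; _*_ to _*R_)

  pow : Carrier → ℕ → Carrier
  pow x zero    = 1#
  pow x (suc n) = x *R pow x n

  Σ≤ : ℕ → (ℕ → Carrier) → Carrier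
  Σ≤ zero    f = f 0
  Σ≤ (suc B) f = Σ≤ B f +R f (suc B)

  Σ01 : (ℕ → Carrier) → Carrier
  Σ01 f = f 0 +R f 1

  -- Bottom-row weights w(a,b;c,d) (a left, b bottom, c right, d top), parameter y.
  w : Carrier → ℕ → ℕ → ℕ → ℕ → Carrier
  w y 0 m       0 d = if m ≡ᵇ d then 1# else 0#
  w y 0 zero    1 d = 0#
  w y 0 (suc m) 1 d = if d ≡ᵇ m then 1# else 0#
  w y 1 m       0 d = if d ≡ᵇ suc m then y else 0#
  w y 1 zero    1 d = if d ≡ᵇ 0 then y +R 1# else 0#
  w y 1 (suc m) 1 d = if d ≡ᵇ suc m then y else 0#
  w y _ _       _ _ = 0#

  wt : Carrier → ℕ → ℕ → ℕ → ℕ → Carrier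
  wt x a b c d = if (a + b) ≡ᵇ (c + d) then pow x (a ⊓ d) else 0#

  -- Partition function of the two-row lattice on the sites j, j+1, …, given the
  -- left labels h1 (bottom row, ∈ {0,1}) and h2 (top row) at the first of these
  -- sites, the remaining bottom labels v and top labels u, and right boundary 0.
  -- The sums over the intermediate vertical label m and the top horizontal
  -- label c2 are truncated at bounds beyond which all weights vanish
  -- (conservation a+b = c+d holds for every nonzero weight).
  Zfrom : Carrier → ℕ → ℕ → {n : ℕ} → Vec ℕ n → Vec ℕ n → Carrier
  Zfrom x h1 h2 []      []      = if (h1 ≡ᵇ 0) ∧ (h2 ≡ᵇ 0) then 1# else 0#
  Zfrom x h1 h2 (b ∷ v) (d ∷ u) =
    Σ01 λ c1 → Σ≤ (h1 + b) λ m → Σ≤ (h2 + m) λ c2 →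
      w (- x) h1 b c1 m *R (wt x h2 m c2 d *R Zfrom x c1 c2 v u)

  -- Full partition function: free left boundary labels are summed over
  -- (h1 ∈ {0,1}; h2 ≤ Σ u by conservation in the top row).
  Z : Carrier → {n : ℕ} → Vec ℕ n → Vec ℕ n → Carrier
  Z x v u = Σ01 λ h1 → Σ≤ (Vec.sum u) λ h2 → Zfrom x h1 h2 v u

  δ : {n : ℕ} → Vec ℕ n → Vec ℕ n → Carrier
  δ u v = if does (≡-dec ℕP._≟_ u v) then 1# else 0#

{-# OPTIONS --safe #-}
-- Feeding a 1 into the bottom row from the left is, up to sign, the same as
-- feeding one more unit into the top row: Zfrom 1 h ≈ - Zfrom 0 (1 + h).
-- This is checked column by column, where the two sides differ only by the
-- extreme configuration in which the top path uses up the whole column, and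
-- these terms cancel.  Summing over the free left boundary therefore
-- telescopes to Zfrom 0 0 minus a term that vanishes by conservation in the
-- top row; with both left labels 0 every column must carry its bottom label
-- straight up, which is δ_{u,v}.
module Submission where

open import Defs
open import Level using (Level)
open import Algebra.Bundles using (CommutativeRing)
open import Data.Nat using (ℕ; zero; suc; _+_; _∸_; _⊓_; _≤_; _<_; _≡ᵇ_; _≤ᵇ_; _≟_; _≤?_; z≤n)
import Data.Nat.Properties as ℕₚ
open import Data.Nat.Properties
  using (≤-refl; ≤-reflexive; ≤-trans; ≤-pred; n≤1+n; m≤m+n; m≤n+m; +-monoʳ-≤; <-cmp; <-trans;
         <⇒≱; ≰⇒>; ≤∧≢⇒<; 1+n≰n; +-suc; +-∸-assoc; m∸n≤m; m∸n+n≡m; m+n∸n≡m; n∸n≡0;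
         m+n≤o⇒m≤o∸n; m≤n⇒m⊓n≡m; m≥n⇒m⊓n≡n)
open import Data.Bool using (Bool; true; false; if_then_else_)
open import Data.Bool.Properties using (if-∧)
open import Data.Vec using (Vec; []; _∷_)
import Data.Vec as Vec
open import Function using (_∘_)
open import Relation.Binary.Definitions using (tri<; tri≈; tri>)
open import Relation.Binary.PropositionalEquality as ≡ using (_≡_; _≢_)
open import Relation.Nullary using (yes; no)
open import Relation.Nullary.Decidable using (dec-true; dec-false)

module _ {a} {A : Set a} {p q : A} where

  if-≡ᵇ-yes : ∀ {m n} → m ≡ n → (if m ≡ᵇ n then p else q) ≡ p
  if-≡ᵇ-yes {m} {n} m≡n = ≡.cong (if_then p else q) (dec-true (m ≟ n) m≡n)

  if-≡ᵇ-no : ∀ {m n} → m ≢ n → (if m ≡ᵇ n then p else q) ≡ q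
  if-≡ᵇ-no {m} {n} m≢n = ≡.cong (if_then p else q) (dec-false (m ≟ n) m≢n)

  if-≤ᵇ-yes : ∀ {m n} → m ≤ n → (if m ≤ᵇ n then p else q) ≡ p
  if-≤ᵇ-yes {m} {n} m≤n = ≡.cong (if_then p else q) (dec-true (m ≤? n) m≤n)

  if-≤ᵇ-no : ∀ {m n} → n < m → (if m ≤ᵇ n then p else q) ≡ q
  if-≤ᵇ-no {m} {n} n<m = ≡.cong (if_then p else q) (dec-false (m ≤? n) (<⇒≱ n<m))

module _ {r ℓ : Level} (R : CommutativeRing r ℓ) where
  open CommutativeRing R hiding (zero) renaming (_+_ to _+R_; _*_ to _*R_)
  open Lattice R
  open import Algebra.Properties.Ring ring using (-0#≈0#; -‿+-comm; -‿distribˡ-*; -‿distribʳ-*)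
  open import Algebra.Properties.AbelianGroup +-abelianGroup using (xyx⁻¹≈y; \\-leftDividesʳ)
  open import Algebra.Properties.CommutativeSemigroup +-commutativeSemigroup using (interchange)
  open import Relation.Binary.Reasoning.Setoid setoid

  if-cong-then-≈ : ∀ b {p p′ q : Carrier} → p ≈ p′ → (if b then p else q) ≈ (if b then p′ else q)
  if-cong-then-≈ true  p≈p′ = p≈p′
  if-cong-then-≈ false p≈p′ = refl

  *-+-cancel : ∀ a t s → a *R (t +R s) +R a *R (- t) ≈ a *R s
  *-+-cancel a t s = trans (sym (distribˡ a (t +R s) (- t))) (*-congˡ (xyx⁻¹≈y t s))

  Σ≤-cong : ∀ B {f g : ℕ → Carrier} → (∀ j → f j ≈ g j) → Σ≤ B f ≈ Σ≤ B g
  Σ≤-cong zero    f≈g = f≈g 0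
  Σ≤-cong (suc B) f≈g = +-cong (Σ≤-cong B f≈g) (f≈g (suc B))

  Σ≤-zero : ∀ B (f : ℕ → Carrier) → (∀ j → j ≤ B → f j ≈ 0#) → Σ≤ B f ≈ 0#
  Σ≤-zero zero    f f≈0 = f≈0 0 z≤n
  Σ≤-zero (suc B) f f≈0 =
    trans (+-cong (Σ≤-zero B f (λ j j≤B → f≈0 j (≤-trans j≤B (n≤1+n B)))) (f≈0 (suc B) ≤-refl))
          (+-identityˡ 0#)

  Σ≤-single : ∀ B k (f : ℕ → Carrier) → k ≤ B → (∀ j → j ≢ k → f j ≈ 0#) → Σ≤ B f ≈ f k
  Σ≤-single zero    zero f z≤n  f≈0 = refl
  Σ≤-single (suc B) k    f k≤B f≈0 with k ≟ suc B
  ... | yes ≡.refl =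
    trans (+-congʳ (Σ≤-zero B f λ j j≤B → f≈0 j λ j≡1+B → 1+n≰n (≡.subst (_≤ B) j≡1+B j≤B)))
          (+-identityˡ _)
  ... | no k≢1+B =
    trans (+-cong (Σ≤-single B k f (≤-pred (≤∧≢⇒< k≤B k≢1+B)) f≈0)
                  (f≈0 (suc B) (k≢1+B ∘ ≡.sym)))
          (+-identityʳ _)

  Σ≤-pick : ∀ B k (e : ℕ → Bool) (a : Carrier) (H : ℕ → Carrier) → k ≤ B →
            e k ≡ true → (∀ j → j ≢ k → e j ≡ false) →
            Σ≤ B (λ j → (if e j then a else 0#) *R H j) ≈ a *R H k
  Σ≤-pick B k e a H k≤B ek ej =
    trans (Σ≤-single B k _ k≤B off-k) (*-congʳ (reflexive (≡.cong (if_then a else 0#) ek)))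
    where
    off-k : ∀ j → j ≢ k → (if e j then a else 0#) *R H j ≈ 0#
    off-k j j≢k rewrite ej j j≢k = zeroˡ (H j)

  Σ≤-pick-≡ᵇ : ∀ B k (a : Carrier) (H : ℕ → Carrier) → k ≤ B →
               Σ≤ B (λ j → (if j ≡ᵇ k then a else 0#) *R H j) ≈ a *R H k
  Σ≤-pick-≡ᵇ B k a H k≤B =
    Σ≤-pick B k (_≡ᵇ k) a H k≤B (dec-true (k ≟ k) ≡.refl) (λ j j≢k → dec-false (j ≟ k) j≢k)

  Σ≤-*ˡ : ∀ B a (f : ℕ → Carrier) → Σ≤ B (λ j → a *R f j) ≈ a *R Σ≤ B f
  Σ≤-*ˡ zero    a f = refl
  Σ≤-*ˡ (suc B) a f = trans (+-congʳ (Σ≤-*ˡ B a f)) (sym (distribˡ a _ _))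

  Σ≤-telescope : ∀ B (f : ℕ → Carrier) → Σ≤ B f +R Σ≤ B (λ j → - f (suc j)) ≈ f 0 +R - f (suc B)
  Σ≤-telescope zero    f = refl
  Σ≤-telescope (suc B) f = begin
    (Σ≤ B f +R f (suc B)) +R (Σ≤ B f′ +R - f (suc (suc B)))  ≈⟨ interchange _ _ _ _ ⟩
    (Σ≤ B f +R Σ≤ B f′) +R (f (suc B) +R - f (suc (suc B)))  ≈⟨ +-congʳ (Σ≤-telescope B f) ⟩
    (f 0 +R - f (suc B)) +R (f (suc B) +R - f (suc (suc B)))  ≈⟨ +-assoc _ _ _ ⟩
    f 0 +R (- f (suc B) +R (f (suc B) +R - f (suc (suc B))))  ≈⟨ +-congˡ (\\-leftDividesʳ _ _) ⟩
    f 0 +R - f (suc (suc B))                                   ∎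
    where
    f′ = λ j → - f (suc j)

  module _ (x : Carrier) where

    -- A top-row vertex with left, bottom and top labels h, m, d, summed against G over
    -- its right label, which conservation forces to be h + m ∸ d.
    column : ℕ → ℕ → ℕ → (ℕ → Carrier) → Carrier
    column h m d G = if d ≤ᵇ h + m then pow x (h ⊓ d) *R G (h + m ∸ d) else 0#

    -- The one configuration that column h (suc m) d G has beyond column h m d (G ∘ suc):
    -- the top path takes the whole column, d = h + m + 1.
    corner : ℕ → ℕ → ℕ → (ℕ → Carrier) → Carrier
    corner h m d G = if d ≡ᵇ suc (h + m) then pow x h *R G 0 else 0#

    column-≤ : ∀ h m d (G : ℕ → Carrier) → d ≤ h + m →
               column h m d G ≡ pow x (h ⊓ d) *R G (h + m ∸ d)
    column-≤ h m d G = if-≤ᵇ-yes {m = d} {n = h + m}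

    column-> : ∀ h m d (G : ℕ → Carrier) → h + m < d → column h m d G ≡ 0#
    column-> h m d G = if-≤ᵇ-no {m = d} {n = h + m}

    column-at : ∀ h m {d e k} (G : ℕ → Carrier) → d ≤ h + m → h ⊓ d ≡ e → h + m ∸ d ≡ k →
                column h m d G ≈ pow x e *R G k
    column-at h m {d} G d≤h+m ≡.refl ≡.refl = reflexive (column-≤ h m d G d≤h+m)

    corner-≡ : ∀ h m (G : ℕ → Carrier) → corner h m (suc (h + m)) G ≡ pow x h *R G 0
    corner-≡ h m G = if-≡ᵇ-yes {m = suc (h + m)} ≡.refl

    corner-≢ : ∀ h m d (G : ℕ → Carrier) → d ≢ suc (h + m) → corner h m d G ≡ 0#
    corner-≢ h m d G = if-≡ᵇ-no {m = d}

    column-cong : ∀ h m d {G G′ : ℕ → Carrier} → (∀ k → G k ≈ G′ k) →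
                  column h m d G ≈ column h m d G′
    column-cong h m d G≈G′ with d ≤ᵇ h + m
    ... | true  = *-congˡ (G≈G′ _)
    ... | false = refl

    column-neg : ∀ h m d (G : ℕ → Carrier) → column h m d (λ k → - G k) ≈ - column h m d G
    column-neg h m d G with d ≤ᵇ h + m
    ... | true  = sym (-‿distribʳ-* _ _)
    ... | false = sym -0#≈0#

    column-vanishes : ∀ h m d n {G : ℕ → Carrier} → (∀ k → n ≤ k → G k ≈ 0#) → n + d ≤ h →
                      column h m d G ≈ 0#
    column-vanishes h m d n G≈0 n+d≤h with d ≤ᵇ h + m
    ... | true  = trans (*-congˡ (G≈0 _ (m+n≤o⇒m≤o∸n n (≤-trans n+d≤h (m≤m+n h m))))) (zeroʳ _)
    ... | false = refl

    column-suc-bottom : ∀ h m d (G : ℕ → Carrier) →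
                        column h (suc m) d G ≈ column h m d (G ∘ suc) +R corner h m d G
    column-suc-bottom h m d G with <-cmp d (suc (h + m))
    ... | tri< d<1+h+m d≢1+h+m _ = let d≤h+m = ≤-pred d<1+h+m in begin
      column h (suc m) d G
        ≈⟨ column-at h (suc m) G (≤-trans d≤h+m (+-monoʳ-≤ h (n≤1+n m))) ≡.refl
                     (≡.trans (≡.cong (_∸ d) (+-suc h m)) (+-∸-assoc 1 d≤h+m)) ⟩
      pow x (h ⊓ d) *R G (suc (h + m ∸ d))
        ≡⟨ column-≤ h m d (G ∘ suc) d≤h+m ⟨
      column h m d (G ∘ suc)
        ≈⟨ +-identityʳ _ ⟨
      column h m d (G ∘ suc) +R 0#
        ≡⟨ ≡.cong (column h m d (G ∘ suc) +R_) (corner-≢ h m d G d≢1+h+m) ⟨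
      column h m d (G ∘ suc) +R corner h m d G ∎
    ... | tri≈ _ ≡.refl _ = begin
      column h (suc m) (suc (h + m)) G
        ≈⟨ column-at h (suc m) G (≤-reflexive (≡.sym (+-suc h m)))
                     (m≤n⇒m⊓n≡m (≤-trans (m≤m+n h m) (n≤1+n _)))
                     (≡.trans (≡.cong (_∸ suc (h + m)) (+-suc h m)) (n∸n≡0 (h + m))) ⟩
      pow x h *R G 0
        ≈⟨ +-identityˡ _ ⟨
      0# +R pow x h *R G 0
        ≡⟨ ≡.cong₂ _+R_ (column-> h m _ (G ∘ suc) ≤-refl) (corner-≡ h m G) ⟨
      column h m (suc (h + m)) (G ∘ suc) +R corner h m (suc (h + m)) G ∎
    ... | tri> _ d≢1+h+m 1+h+m<d = begin
      column h (suc m) d G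
        ≡⟨ column-> h (suc m) d G (≡.subst (_< d) (≡.sym (+-suc h m)) 1+h+m<d) ⟩
      0#
        ≈⟨ +-identityˡ 0# ⟨
      0# +R 0#
        ≡⟨ ≡.cong₂ _+R_ (column-> h m d (G ∘ suc) (<-trans ≤-refl 1+h+m<d))
                        (corner-≢ h m d G d≢1+h+m) ⟨
      column h m d (G ∘ suc) +R corner h m d G ∎

    column-suc-left : ∀ h d (G : ℕ → Carrier) →
                      column (suc h) 0 d G ≈ column h 0 d (G ∘ suc) +R x *R corner h 0 d G
    column-suc-left h d G with <-cmp d (suc (h + 0))
    ... | tri< d<1+h+0 d≢1+h+0 _ = let d≤h+0 = ≤-pred d<1+h+0
                                       d≤h   = ≤-trans d≤h+0 (≤-reflexive (ℕₚ.+-identityʳ h)) in begin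
      column (suc h) 0 d G
        ≈⟨ column-at (suc h) 0 G (≤-trans d≤h+0 (n≤1+n _))
                     (≡.trans (m≥n⇒m⊓n≡n (≤-trans d≤h (n≤1+n h))) (≡.sym (m≥n⇒m⊓n≡n d≤h)))
                     (+-∸-assoc 1 d≤h+0) ⟩
      pow x (h ⊓ d) *R G (suc (h + 0 ∸ d))
        ≡⟨ column-≤ h 0 d (G ∘ suc) d≤h+0 ⟨
      column h 0 d (G ∘ suc)
        ≈⟨ trans (+-congˡ (zeroʳ x)) (+-identityʳ _) ⟨
      column h 0 d (G ∘ suc) +R x *R 0#
        ≡⟨ ≡.cong (λ t → column h 0 d (G ∘ suc) +R x *R t) (corner-≢ h 0 d G d≢1+h+0) ⟨
      column h 0 d (G ∘ suc) +R x *R corner h 0 d G ∎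
    ... | tri≈ _ ≡.refl _ = begin
      column (suc h) 0 (suc (h + 0)) G
        ≈⟨ column-at (suc h) 0 G ≤-refl (≡.cong suc (m≤n⇒m⊓n≡m (m≤m+n h 0))) (n∸n≡0 (h + 0)) ⟩
      x *R pow x h *R G 0
        ≈⟨ trans (*-assoc x (pow x h) (G 0)) (sym (+-identityˡ _)) ⟩
      0# +R x *R (pow x h *R G 0)
        ≡⟨ ≡.cong₂ (λ s t → s +R x *R t) (column-> h 0 _ (G ∘ suc) ≤-refl) (corner-≡ h 0 G) ⟨
      column h 0 (suc (h + 0)) (G ∘ suc) +R x *R corner h 0 (suc (h + 0)) G ∎
    ... | tri> _ d≢1+h+0 1+h+0<d = begin
      column (suc h) 0 d G
        ≡⟨ column-> (suc h) 0 d G 1+h+0<d ⟩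
      0#
        ≈⟨ trans (+-congˡ (zeroʳ x)) (+-identityˡ 0#) ⟨
      0# +R x *R 0#
        ≡⟨ ≡.cong₂ (λ s t → s +R x *R t) (column-> h 0 d (G ∘ suc) (<-trans ≤-refl 1+h+0<d))
                                         (corner-≢ h 0 d G d≢1+h+0) ⟨
      column h 0 d (G ∘ suc) +R x *R corner h 0 d G ∎

    corner-suc-left : ∀ h m d (G : ℕ → Carrier) → corner (suc h) m d G ≈ x *R corner h (suc m) d G
    corner-suc-left h m d G rewrite +-suc h m with d ≡ᵇ suc (suc (h + m))
    ... | true  = *-assoc x (pow x h) (G 0)
    ... | false = sym (zeroʳ x)

    Σ≤-wt≈column : ∀ h m d (G : ℕ → Carrier) →
                   Σ≤ (h + m) (λ c → wt x h m c d *R G c) ≈ column h m d G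
    Σ≤-wt≈column h m d G with d ≤? h + m
    ... | yes d≤h+m = begin
      Σ≤ (h + m) (λ c → wt x h m c d *R G c)
        ≈⟨ Σ≤-pick (h + m) (h + m ∸ d) (λ c → h + m ≡ᵇ c + d) _ G (m∸n≤m (h + m) d)
                   (dec-true (h + m ≟ h + m ∸ d + d) (≡.sym (m∸n+n≡m d≤h+m)))
                   (λ c c≢h+m∸d → dec-false (h + m ≟ c + d) (c≢h+m∸d ∘ right-label)) ⟩
      pow x (h ⊓ d) *R G (h + m ∸ d)
        ≡⟨ column-≤ h m d G d≤h+m ⟨
      column h m d G ∎
      where
      right-label : ∀ {c} → h + m ≡ c + d → c ≡ h + m ∸ d
      right-label {c} eq = ≡.trans (≡.sym (m+n∸n≡m c d)) (≡.cong (_∸ d) (≡.sym eq))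
    ... | no d≰h+m = begin
      Σ≤ (h + m) (λ c → wt x h m c d *R G c)
        ≈⟨ Σ≤-zero (h + m) _ (λ c _ →
             trans (*-congʳ (reflexive (if-≡ᵇ-no (d≰h+m ∘ d≤h+m {c})))) (zeroˡ _)) ⟩
      0#
        ≡⟨ column-> h m d G (≰⇒> d≰h+m) ⟨
      column h m d G ∎
      where
      d≤h+m : ∀ {c} → h + m ≡ c + d → d ≤ h + m
      d≤h+m {c} eq = ≡.subst (d ≤_) (≡.sym eq) (m≤n+m d c)

    Zfrom-cons : ∀ {n} h₁ h₂ b d (v u : Vec ℕ n) →
                 Zfrom x h₁ h₂ (b ∷ v) (d ∷ u)
                   ≈ Σ01 (λ c₁ → Σ≤ (h₁ + b) (λ m →
                       w (- x) h₁ b c₁ m *R column h₂ m d (λ c₂ → Zfrom x c₁ c₂ v u)))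
    Zfrom-cons h₁ h₂ b d v u = +-cong (sum-top-row 0) (sum-top-row 1)
      where
      sum-top-row : ∀ c₁ →
        Σ≤ (h₁ + b) (λ m → Σ≤ (h₂ + m) λ c₂ →
            w (- x) h₁ b c₁ m *R (wt x h₂ m c₂ d *R Zfrom x c₁ c₂ v u))
          ≈ Σ≤ (h₁ + b) (λ m → w (- x) h₁ b c₁ m *R column h₂ m d (λ c₂ → Zfrom x c₁ c₂ v u))
      sum-top-row c₁ = Σ≤-cong (h₁ + b) λ m →
        trans (Σ≤-*ˡ (h₂ + m) (w (- x) h₁ b c₁ m) _)
              (*-congˡ (Σ≤-wt≈column h₂ m d (λ c₂ → Zfrom x c₁ c₂ v u)))

    -- The column above a bottom vertex w(0,b;1,b-1), which exists only for b ≥ 1.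
    column₁ : ℕ → ℕ → ℕ → (ℕ → Carrier) → Carrier
    column₁ h zero    d G = 0#
    column₁ h (suc b) d G = column h b d G

    -- w (- x) 1 b 1 b
    w₁₁ : ℕ → Carrier
    w₁₁ zero    = - x +R 1#
    w₁₁ (suc b) = - x

    column₁-cong : ∀ h b d {G G′ : ℕ → Carrier} → (∀ k → G k ≈ G′ k) →
                   column₁ h b d G ≈ column₁ h b d G′
    column₁-cong h zero    d G≈G′ = refl
    column₁-cong h (suc b) d G≈G′ = column-cong h b d G≈G′

    column₁-vanishes : ∀ h b d n {G : ℕ → Carrier} → (∀ k → n ≤ k → G k ≈ 0#) → n + d ≤ h →
                       column₁ h b d G ≈ 0#
    column₁-vanishes h zero    d n G≈0 n+d≤h = refl
    column₁-vanishes h (suc b) d n G≈0 n+d≤h = column-vanishes h b d n G≈0 n+d≤h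

    Zfrom-zero-cons : ∀ {n} h b d (v u : Vec ℕ n) →
                      Zfrom x 0 h (b ∷ v) (d ∷ u)
                        ≈ column h b d (λ k → Zfrom x 0 k v u) +R column₁ h b d (λ k → Zfrom x 1 k v u)
    Zfrom-zero-cons h b d v u = trans (Zfrom-cons 0 h b d v u) (+-cong straight (turn b))
      where
      straight : Σ≤ b (λ m → w (- x) 0 b 0 m *R column h m d (λ k → Zfrom x 0 k v u))
                   ≈ column h b d (λ k → Zfrom x 0 k v u)
      straight = trans (Σ≤-pick b b (b ≡ᵇ_) 1# _ ≤-refl (dec-true (b ≟ b) ≡.refl)
                                 (λ m m≢b → dec-false (b ≟ m) (m≢b ∘ ≡.sym)))
                       (*-identityˡ _)
      turn : ∀ b → Σ≤ b (λ m → w (- x) 0 b 1 m *R column h m d (λ k → Zfrom x 1 k v u))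
                     ≈ column₁ h b d (λ k → Zfrom x 1 k v u)
      turn zero    = zeroˡ _
      turn (suc b) = trans (Σ≤-pick-≡ᵇ (suc b) b 1# _ (n≤1+n b)) (*-identityˡ _)

    Zfrom-one-cons : ∀ {n} h b d (v u : Vec ℕ n) →
                     Zfrom x 1 h (b ∷ v) (d ∷ u)
                       ≈ (- x) *R column h (suc b) d (λ k → Zfrom x 0 k v u)
                           +R w₁₁ b *R column h b d (λ k → Zfrom x 1 k v u)
    Zfrom-one-cons h b d v u =
      trans (Zfrom-cons 1 h b d v u) (+-cong (Σ≤-pick-≡ᵇ (suc b) (suc b) (- x) _ ≤-refl) (loop b))
      where
      loop : ∀ b → Σ≤ (suc b) (λ m → w (- x) 1 b 1 m *R column h m d (λ k → Zfrom x 1 k v u))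
                     ≈ w₁₁ b *R column h b d (λ k → Zfrom x 1 k v u)
      loop zero    = Σ≤-pick-≡ᵇ 1 0 (- x +R 1#) (λ m → column h m d (λ k → Zfrom x 1 k v u)) z≤n
      loop (suc b) = Σ≤-pick-≡ᵇ (suc (suc b)) (suc b) (- x) _ (n≤1+n (suc b))

    -x-cancel : ∀ t s → (- x) *R (t +R s) +R (- x) *R (- t) ≈ - (x *R s)
    -x-cancel t s = trans (*-+-cancel (- x) t s) (sym (-‿distribˡ-* x s))

    -- One column of Zfrom-one≈-Zfrom-zero-suc, after its induction hypothesis G₁ ≈ - G ∘ suc is used.
    column-exchange : ∀ h b d (G : ℕ → Carrier) →
                      (- x) *R column h (suc b) d G +R w₁₁ b *R (- column h b d (G ∘ suc))
                        ≈ - (column (suc h) b d G +R column₁ (suc h) b d (λ k → - G (suc k)))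
    column-exchange h zero d G = begin
      (- x) *R column h 1 d G +R (- x +R 1#) *R (- t)
        ≈⟨ +-congʳ (*-congˡ (column-suc-bottom h 0 d G)) ⟩
      (- x) *R (t +R c) +R (- x +R 1#) *R (- t)
        ≈⟨ +-congˡ (distribʳ (- t) (- x) 1#) ⟩
      (- x) *R (t +R c) +R ((- x) *R (- t) +R 1# *R (- t))
        ≈⟨ +-assoc _ _ _ ⟨
      ((- x) *R (t +R c) +R (- x) *R (- t)) +R 1# *R (- t)
        ≈⟨ +-cong (-x-cancel t c) (*-identityˡ (- t)) ⟩
      - (x *R c) +R - t
        ≈⟨ -‿+-comm (x *R c) t ⟩
      - (x *R c +R t)
        ≈⟨ -‿cong (trans (+-comm _ _) (sym (+-identityʳ _))) ⟩
      - ((t +R x *R c) +R 0#)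
        ≈⟨ -‿cong (+-congʳ (column-suc-left h d G)) ⟨
      - (column (suc h) 0 d G +R 0#) ∎
      where
      t = column h 0 d (G ∘ suc)
      c = corner h 0 d G
    column-exchange h (suc b) d G = begin
      (- x) *R column h (suc (suc b)) d G +R (- x) *R (- t)
        ≈⟨ +-congʳ (*-congˡ (column-suc-bottom h (suc b) d G)) ⟩
      (- x) *R (t +R c) +R (- x) *R (- t)
        ≈⟨ -x-cancel t c ⟩
      - (x *R c)
        ≈⟨ -‿cong (corner-suc-left h b d G) ⟨
      - corner (suc h) b d G
        ≈⟨ -‿cong (xyx⁻¹≈y s _) ⟨
      - ((s +R corner (suc h) b d G) +R - s)
        ≈⟨ -‿cong (+-cong (column-suc-bottom (suc h) b d G) (column-neg (suc h) b d (G ∘ suc))) ⟨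
      - (column (suc h) (suc b) d G +R column (suc h) b d (λ k → - G (suc k))) ∎
      where
      t = column h (suc b) d (G ∘ suc)
      c = corner h (suc b) d G
      s = column (suc h) b d (G ∘ suc)

    Zfrom-one≈-Zfrom-zero-suc : ∀ {n} (v u : Vec ℕ n) h → Zfrom x 1 h v u ≈ - Zfrom x 0 (suc h) v u
    Zfrom-one≈-Zfrom-zero-suc []      []      h = sym -0#≈0#
    Zfrom-one≈-Zfrom-zero-suc (b ∷ v) (d ∷ u) h = begin
      Zfrom x 1 h (b ∷ v) (d ∷ u)
        ≈⟨ Zfrom-one-cons h b d v u ⟩
      (- x) *R column h (suc b) d G₀ +R w₁₁ b *R column h b d G₁
        ≈⟨ +-congˡ (*-congˡ (trans (column-cong h b d IH) (column-neg h b d (G₀ ∘ suc)))) ⟩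
      (- x) *R column h (suc b) d G₀ +R w₁₁ b *R (- column h b d (G₀ ∘ suc))
        ≈⟨ column-exchange h b d G₀ ⟩
      - (column (suc h) b d G₀ +R column₁ (suc h) b d (λ k → - G₀ (suc k)))
        ≈⟨ -‿cong (+-congˡ (column₁-cong (suc h) b d IH)) ⟨
      - (column (suc h) b d G₀ +R column₁ (suc h) b d G₁)
        ≈⟨ -‿cong (Zfrom-zero-cons (suc h) b d v u) ⟨
      - Zfrom x 0 (suc h) (b ∷ v) (d ∷ u) ∎
      where
      G₀ = λ k → Zfrom x 0 k v u
      G₁ = λ k → Zfrom x 1 k v u
      IH = Zfrom-one≈-Zfrom-zero-suc v u

    Zfrom-zero-vanishes : ∀ {n} (v u : Vec ℕ n) h → Vec.sum u < h → Zfrom x 0 h v u ≈ 0#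
    Zfrom-zero-vanishes []      []      (suc h) _        = refl
    Zfrom-zero-vanishes (b ∷ v) (d ∷ u) h       d+Σu<h = begin
      Zfrom x 0 h (b ∷ v) (d ∷ u)
        ≈⟨ Zfrom-zero-cons h b d v u ⟩
      column h b d G₀ +R column₁ h b d G₁
        ≈⟨ +-cong (column-vanishes h b d _ G₀≈0 bound) (column₁-vanishes h b d _ G₁≈0 bound) ⟩
      0# +R 0#
        ≈⟨ +-identityʳ 0# ⟩
      0# ∎
      where
      G₀ = λ k → Zfrom x 0 k v u
      G₁ = λ k → Zfrom x 1 k v u
      G₀≈0 : ∀ k → suc (Vec.sum u) ≤ k → G₀ k ≈ 0#
      G₀≈0 = Zfrom-zero-vanishes v u
      G₁≈0 : ∀ k → suc (Vec.sum u) ≤ k → G₁ k ≈ 0#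
      G₁≈0 k Σu<k = trans (Zfrom-one≈-Zfrom-zero-suc v u k)
                          (trans (-‿cong (G₀≈0 (suc k) (≤-trans Σu<k (n≤1+n k)))) -0#≈0#)
      bound : suc (Vec.sum u) + d ≤ h
      bound = ≤-trans (≤-reflexive (≡.cong suc (ℕₚ.+-comm (Vec.sum u) d))) d+Σu<h

    column-diagonal : ∀ b d (G G₁ : ℕ → Carrier) → (∀ k → G₁ k ≈ - G (suc k)) →
                      column 0 b d G +R column₁ 0 b d G₁ ≈ (if d ≡ᵇ b then G 0 else 0#)
    column-diagonal zero    zero    G G₁ _ = trans (+-identityʳ _) (*-identityˡ _)
    column-diagonal zero    (suc d) G G₁ _ = +-identityʳ 0#
    column-diagonal (suc b) d       G G₁ G₁≈-G∘suc = begin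
      column 0 (suc b) d G +R column 0 b d G₁
        ≈⟨ +-cong (column-suc-bottom 0 b d G)
                  (trans (column-cong 0 b d G₁≈-G∘suc) (column-neg 0 b d (G ∘ suc))) ⟩
      (column 0 b d (G ∘ suc) +R corner 0 b d G) +R - column 0 b d (G ∘ suc)
        ≈⟨ xyx⁻¹≈y _ _ ⟩
      (if d ≡ᵇ suc b then 1# *R G 0 else 0#)
        ≈⟨ if-cong-then-≈ (d ≡ᵇ suc b) (*-identityˡ (G 0)) ⟩
      (if d ≡ᵇ suc b then G 0 else 0#) ∎

    Zfrom-zero-zero≈δ : ∀ {n} (v u : Vec ℕ n) → Zfrom x 0 0 v u ≈ δ u v
    Zfrom-zero-zero≈δ []      []      = refl
    Zfrom-zero-zero≈δ (b ∷ v) (d ∷ u) = begin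
      Zfrom x 0 0 (b ∷ v) (d ∷ u)
        ≈⟨ Zfrom-zero-cons 0 b d v u ⟩
      column 0 b d G₀ +R column₁ 0 b d (λ k → Zfrom x 1 k v u)
        ≈⟨ column-diagonal b d G₀ _ (Zfrom-one≈-Zfrom-zero-suc v u) ⟩
      (if d ≡ᵇ b then Zfrom x 0 0 v u else 0#)
        ≈⟨ if-cong-then-≈ (d ≡ᵇ b) (Zfrom-zero-zero≈δ v u) ⟩
      (if d ≡ᵇ b then δ u v else 0#)
        ≡⟨ if-∧ (d ≡ᵇ b) ⟨
      δ (d ∷ u) (b ∷ v) ∎
      where
      G₀ = λ k → Zfrom x 0 k v u

    Z≈δ : ∀ {n} (v u : Vec ℕ n) → Z x v u ≈ δ u v
    Z≈δ v u = begin
      Σ≤ S G₀ +R Σ≤ S (λ k → Zfrom x 1 k v u)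
        ≈⟨ +-congˡ (Σ≤-cong S (Zfrom-one≈-Zfrom-zero-suc v u)) ⟩
      Σ≤ S G₀ +R Σ≤ S (λ k → - G₀ (suc k))
        ≈⟨ Σ≤-telescope S G₀ ⟩
      G₀ 0 +R - G₀ (suc S)
        ≈⟨ +-cong (Zfrom-zero-zero≈δ v u) (-‿cong (Zfrom-zero-vanishes v u (suc S) ≤-refl)) ⟩
      δ u v +R - 0#
        ≈⟨ trans (+-congˡ -0#≈0#) (+-identityʳ _) ⟩
      δ u v ∎
      where
      S = Vec.sum u
      G₀ = λ k → Zfrom x 0 k v u

proposition5p2 : {c ℓ : Level} (R : CommutativeRing c ℓ) (x : CommutativeRing.Carrier R)
    (n : ℕ) (v u : Vec ℕ n) →
    CommutativeRing._≈_ R (Lattice.Z R x v u) (Lattice.δ R u v)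
proposition5p2 R x n v u = Z≈δ R x v u
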